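{- Let $x_1,\dots,x_n$ be $\{0,1\}$-valued variables, and let $t,d$ satisfy $(t-1)d^2\le n$. Let $\mathcal F$ be a family of conjunctions of degree $\le d$ over these variables such that for every $\mathcal S\subseteq\mathcal F$ with $|\mathcal S|=t$, $\prod_{C\in\mathcal S}C\equiv 0$. If $\tilde{\mathbb E}$ is a pseudoexpectation operator of degree $D\ge(t-1)d^2$, then $\tilde{\mathbb E}[\mathcal F]\le t-1$.
   Context: Multilinear polynomials are taken modulo $x_i^2=x_i$. A conjunction is $C_{S,T}=\prod_{i\in S}x_i\prod_{j\in T}(1-x_j)$ with $S\cap T=\emptyset$, of degree $|S|+|T|$; $\prod C\equiv 0$ means the conjunctions are mutually inconsistent. A degree-$D$ pseudoexpectation is a linear map $\tilde{\mathbb E}$ on multilinear polynomials of degree $\le D$ with $\tilde{\mathbb E}[1]=1$ and $\tilde{\mathbb E}[C]\ge0$ for all conjunctions $C$ of degree $\le D$. For a family $\mathcal F$, $\tilde{\mathbb E}[\mathcal F]=\sum_{C\in\mathcal F}\tilde{\mathbb E}[C]$.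
   Formalization: The pseudoexpectation $\tilde{\mathbb E}$ takes rational values in place of real ones and is defined on multilinear polynomials with rational coefficients. -}

module Defs where

open import Data.Nat using (ℕ; zero; suc) renaming (_+_ to _+ℕ_)
open import Data.Bool using (Bool; true; false; if_then_else_)
import Data.Bool as Bool
open import Data.Fin using (Fin)
open import Data.Fin.Subset using (Subset; ∣_∣; _∪_; _∩_; ⁅_⁆) renaming (⊥ to ∅)
open import Data.Vec using (Vec; []; _∷_; lookup)
open import Data.Vec.Properties using (≡-dec)
open import Data.List using (List; []; _∷_; map; _++_; foldr; allFin)
open import Data.Product using (_×_; _,_; proj₁; proj₂)
open import Data.Rational using (ℚ; 0ℚ; 1ℚ; _+_; _*_; _-_)
open import Relation.Nullary using (yes; no; Dec)
import Data.Nat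
import Data.Rational
open import Relation.Binary.PropositionalEquality using (_≡_)

_≟S_ : ∀ {n} (A B : Subset n) → Dec (A ≡ B)
_≟S_ = ≡-dec Bool._≟_

allSubsets : (n : ℕ) → List (Subset n)
allSubsets zero = [] ∷ []
allSubsets (suc n) = map (true ∷_) (allSubsets n) ++ map (false ∷_) (allSubsets n)

sumℚ : List ℚ → ℚ
sumℚ = foldr _+_ 0ℚ

-- A multilinear polynomial in x_1..x_n with rational coefficients
-- (i.e. a polynomial modulo x_i^2 = x_i), given by its coefficient
-- on each multilinear monomial x_U = ∏_{i ∈ U} x_i.
Poly : ℕ → Set
Poly n = Subset n → ℚ

IsZero : ∀ {n} → Poly n → Set
IsZero p = ∀ U → p U ≡ 0ℚ

constP : ∀ {n} → ℚ → Poly n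
constP c U with U ≟S ∅
... | yes _ = c
... | no _ = 0ℚ

oneP : ∀ {n} → Poly n
oneP = constP 1ℚ

varP : ∀ {n} → Fin n → Poly n
varP i U with U ≟S ⁅ i ⁆
... | yes _ = 1ℚ
... | no _ = 0ℚ

_-P_ : ∀ {n} → Poly n → Poly n → Poly n
(p -P q) U = p U - q U

-- multiplication modulo x_i^2 = x_i : x_A · x_B = x_{A ∪ B}
_*P_ : ∀ {n} → Poly n → Poly n → Poly n
_*P_ {n} p q U = sumℚ (map (λ A → sumℚ (map (λ B → term A B) (allSubsets n))) (allSubsets n))
  where
  term : Subset n → Subset n → ℚ
  term A B with (A ∪ B) ≟S U
  ... | yes _ = p A * q B
  ... | no _ = 0ℚ

prodP : ∀ {n} → List (Poly n) → Poly n
prodP = foldr _*P_ oneP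

Conj : ℕ → Set
Conj n = Subset n × Subset n

WellFormed : ∀ {n} → Conj n → Set
WellFormed (S , T) = S ∩ T ≡ ∅

degree : ∀ {n} → Conj n → ℕ
degree (S , T) = ∣ S ∣ +ℕ ∣ T ∣

conjP : ∀ {n} → Conj n → Poly n
conjP {n} (S , T) = prodP (map factor (allFin n))
  where
  factor : Fin n → Poly n
  factor i = (if lookup S i then varP i else oneP)
             *P (if lookup T i then (oneP -P varP i) else oneP)

-- Linear functionals on multilinear polynomials are determined by their
-- values L U on the monomials x_U (Ẽ[p] = Σ_U p_U · L U).  Only the values
-- with |U| ≤ D matter, as Ẽ is only ever applied to polynomials of degree ≤ D.
applyL : ∀ {n} → (Subset n → ℚ) → Poly n → ℚ
applyL {n} L p = sumℚ (map (λ U → p U * L U) (allSubsets n))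

record PseudoExpectation (n D : ℕ) : Set where
  field
    L : Subset n → ℚ
    normalized : applyL L oneP ≡ 1ℚ
    nonneg : ∀ (C : Conj n) → WellFormed C → degree C Data.Nat.≤ D →
             0ℚ Data.Rational.≤ applyL L (conjP C)

Ẽ[_]_ : ∀ {n D} → PseudoExpectation n D → Poly n → ℚ
Ẽ[ E ] p = applyL (PseudoExpectation.L E) p

Ẽfam : ∀ {n D} → PseudoExpectation n D → List (Conj n) → ℚ
Ẽfam E F = sumℚ (map (λ C → Ẽ[ E ] (conjP C)) F)

{-# OPTIONS --safe #-}
-- Grow a decision tree over the variables from the empty restriction.  Since
-- Ẽ[A] = Ẽ[A ∧ x_v] + Ẽ[A ∧ ¬x_v], the bound Σ_{C ∈ F} Ẽ[C ∧ ρ] ≤ (t-1)·Ẽ[ρ] holds at a node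
-- once it holds at both children.  At a leaf ρ every C consistent with ρ is implied by ρ, so
-- the sum is (number of such C)·Ẽ[ρ]; these C all hold at the point that is 1 exactly on the
-- positive literals of ρ, so no t of them have product 0 and there are at most t-1 of them.
-- The tree grows in rounds: from ρ, greedily choose a maximal P ⊆ F consistent with ρ
-- (so |P| ≤ t-1 as before) and branch on the at most (t-1)d variables of P.  Afterwards every
-- C still consistent has lost a free variable, one it shares with P or one where it clashes
-- with P, so after d rounds the leaves are reached at depth (t-1)d² ≤ D.
-- Polynomial identities are checked on the cube {0,1}ⁿ, where a multilinear polynomial is
-- determined by its values.
module Submission where

open import Algebra.Bundles using (CommutativeRing; CommutativeMonoid)
open import Data.List using (List; []; _∷_; map; foldr; _++_)
open import Level using (Level)

module ListSum {c ℓ} (R : CommutativeRing c ℓ) where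

  open CommutativeRing R renaming (refl to ≈-refl; sym to ≈-sym; trans to ≈-trans)
  open import Algebra.Properties.CommutativeSemigroup +-commutativeSemigroup using (interchange)
  open import Algebra.Properties.AbelianGroup +-abelianGroup using (ε⁻¹≈ε; ⁻¹-∙-comm)
  open import Relation.Binary.Reasoning.Setoid setoid

  private
    variable
      a b : Level
      A B : Set a

  ∑ : (A → Carrier) → List A → Carrier
  ∑ f xs = foldr _+_ 0# (map f xs)

  ∑-cong : {f g : A → Carrier} → (∀ x → f x ≈ g x) → ∀ xs → ∑ f xs ≈ ∑ g xs
  ∑-cong f≈g []       = ≈-refl
  ∑-cong f≈g (x ∷ xs) = +-cong (f≈g x) (∑-cong f≈g xs)

  ∑-zero : {f : A → Carrier} → (∀ x → f x ≈ 0#) → ∀ xs → ∑ f xs ≈ 0#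
  ∑-zero f≈0 []       = ≈-refl
  ∑-zero f≈0 (x ∷ xs) = ≈-trans (+-cong (f≈0 x) (∑-zero f≈0 xs)) (+-identityˡ 0#)

  ∑-+ : (f g : A → Carrier) → ∀ xs → ∑ (λ x → f x + g x) xs ≈ ∑ f xs + ∑ g xs
  ∑-+ f g []       = ≈-sym (+-identityˡ 0#)
  ∑-+ f g (x ∷ xs) = ≈-trans (+-congˡ (∑-+ f g xs)) (interchange (f x) (g x) (∑ f xs) (∑ g xs))

  ∑-neg : (f : A → Carrier) → ∀ xs → ∑ (λ x → - f x) xs ≈ - ∑ f xs
  ∑-neg f []       = ≈-sym ε⁻¹≈ε
  ∑-neg f (x ∷ xs) = ≈-trans (+-congˡ (∑-neg f xs)) (⁻¹-∙-comm (f x) (∑ f xs))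

  ∑-*ˡ : ∀ c (f : A → Carrier) xs → ∑ (λ x → c * f x) xs ≈ c * ∑ f xs
  ∑-*ˡ c f []       = ≈-sym (zeroʳ c)
  ∑-*ˡ c f (x ∷ xs) = ≈-trans (+-congˡ (∑-*ˡ c f xs)) (≈-sym (distribˡ c (f x) (∑ f xs)))

  ∑-*ʳ : ∀ c (f : A → Carrier) xs → ∑ (λ x → f x * c) xs ≈ ∑ f xs * c
  ∑-*ʳ c f []       = ≈-sym (zeroˡ c)
  ∑-*ʳ c f (x ∷ xs) = ≈-trans (+-congˡ (∑-*ʳ c f xs)) (≈-sym (distribʳ c (f x) (∑ f xs)))

  ∑-++ : (f : A → Carrier) → ∀ xs ys → ∑ f (xs ++ ys) ≈ ∑ f xs + ∑ f ys
  ∑-++ f []       ys = ≈-sym (+-identityˡ (∑ f ys))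
  ∑-++ f (x ∷ xs) ys = ≈-trans (+-congˡ (∑-++ f xs ys)) (≈-sym (+-assoc (f x) (∑ f xs) (∑ f ys)))

  ∑-map : (f : B → Carrier) (g : A → B) → ∀ xs → ∑ f (map g xs) ≈ ∑ (λ x → f (g x)) xs
  ∑-map f g []       = ≈-refl
  ∑-map f g (x ∷ xs) = +-congˡ (∑-map f g xs)

  ∑-swap : (f : A → B → Carrier) → ∀ xs ys →
           ∑ (λ x → ∑ (f x) ys) xs ≈ ∑ (λ y → ∑ (λ x → f x y) xs) ys
  ∑-swap f []       ys = ≈-sym (∑-zero (λ _ → ≈-refl) ys)
  ∑-swap f (x ∷ xs) ys = begin
    ∑ (f x) ys + ∑ (λ x → ∑ (f x) ys) xs         ≈⟨ +-congˡ (∑-swap f xs ys) ⟩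
    ∑ (f x) ys + ∑ (λ y → ∑ (λ x → f x y) xs) ys ≈⟨ ∑-+ (f x) _ ys ⟨
    ∑ (λ y → f x y + ∑ (λ x → f x y) xs) ys      ∎

open import Defs
open import Data.Bool using (Bool; true; false; not; _∧_; _∨_; if_then_else_)
open import Data.Bool.Properties
  using (∧-identityʳ; ∧-idem; ∧-zeroʳ; ∧-conicalˡ; ∧-commutativeMonoid; ∨-∧-booleanAlgebra)
open import Data.Fin using (Fin; zero; suc)
open import Data.Fin.Subset
  using (Subset; ⁅_⁆; ∁; _∪_; _∩_; _∈_; _∉_; ∣_∣; Empty) renaming (⊥ to ∅; _⊆_ to _⊆ˢ_)
open import Data.Fin.Subset.Properties
  using ( _∈?_; nonempty?; Empty-unique; ∉⊥; x∈⁅x⁆; x∈p∪q⁺; x∈p∪q⁻; x∈p∩q⁺; x∈p∩q⁻; x∈∁p⇒x∉p; x∉p⇒x∈∁p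
        ; p⊆p∪q; q⊆p∪q; p∩q⊆p; ⊆-refl; ⊆-trans; ⊆-antisym; ∪-assoc; ∪-identityʳ
        ; ∣⊥∣≡0; ∣⁅x⁆∣≡1; p⊆q⇒∣p∣≤∣q∣; p⊂q⇒∣p∣<∣q∣; x∈p⇒∣p-x∣<∣p∣ )
open import Data.Integer using (+_)
import Data.Integer as ℤ
import Data.Integer.Properties as ℤ
open import Data.List using (length; take; tabulate; allFin)
open import Data.List.Membership.Propositional using () renaming (_∈_ to _∈ˡ_)
open import Data.List.Membership.Propositional.Properties using (∈-map⁺)
open import Data.List.Properties using (map-tabulate; length-map; length-take)
open import Data.List.Relation.Binary.Sublist.Propositional
  using (_⊆_; []; _∷_; _∷ʳ_) renaming (⊆-trans to ⊆ˡ-trans)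
open import Data.List.Relation.Binary.Sublist.Propositional.Properties using (take-⊆; All-resp-⊆)
open import Data.List.Relation.Unary.All as All using (All; []; _∷_)
open import Data.List.Relation.Unary.Any using (here; there)
open import Data.List.Relation.Unary.Unique.Propositional using (Unique)
open import Data.Nat using (ℕ; zero; suc; _*_; _∸_; _≤_; _<_; _≤?_; z≤n; s≤s) renaming (_+_ to _+ℕ_)
open import Data.Nat.Coprimality using (Coprime; 1-coprimeTo) renaming (sym to Coprime-sym)
open import Data.Nat.Properties
  using ( ≤-trans; ≤-reflexive; ≤-pred; ≰⇒>; m≤m+n; n≤1+n; +-mono-≤; +-monoˡ-≤; +-monoʳ-≤; *-monoˡ-≤
        ; ∸-monoˡ-≤; m≤n⇒m⊓n≡m; +-assoc; +-identityʳ; +-suc; *-suc; *-assoc; +-commutativeSemigroup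
        ; module ≤-Reasoning )
open import Data.Product using (Σ-syntax; ∃; ∃-syntax; _×_; _,_; proj₁; proj₂)
open import Data.Rational
  using (ℚ; mkℚ; 0ℚ; 1ℚ; _+_; _-_; -_; _/_; nonNegative) renaming (_*_ to _·_; _≤_ to _≤ℚ_)
import Data.Rational.Properties as ℚ
open import Data.Sum as Sum using (_⊎_; inj₁; inj₂)
open import Data.Vec using (_∷_; []; lookup; here; there)
import Data.Vec.Functional as Vector
open import Data.Vec.Properties using (∷-injectiveˡ; ∷-injectiveʳ)
open import Function using (_∘_)
open import Relation.Binary.PropositionalEquality
  using (_≡_; _≢_; refl; sym; trans; cong; cong₂; subst; module ≡-Reasoning)
open import Relation.Nullary using (¬_; Dec; yes; no; contradiction)

open ListSum ℚ.+-*-commutativeRing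
open import Algebra.Properties.CommutativeSemigroup (CommutativeMonoid.commutativeSemigroup ℚ.*-1-commutativeMonoid)
  using (x∙yz≈y∙xz) renaming (interchange to ·-interchange)
open import Algebra.Properties.CommutativeSemigroup (CommutativeMonoid.commutativeSemigroup ∧-commutativeMonoid)
  using () renaming (interchange to ∧-interchange)
open import Algebra.Properties.CommutativeSemigroup +-commutativeSemigroup
  using () renaming (interchange to +-interchange)
open import Algebra.Properties.Group ℚ.+-0-group using () renaming (∙-cancelˡ to +-cancelˡ)
open import Algebra.Lattice.Properties.BooleanAlgebra ∨-∧-booleanAlgebra using (deMorgan₂)

private
  variable
    n : ℕ

+suc/1 : ∀ k → + suc k / 1 ≡ 1ℚ + + k / 1
+suc/1 k = begin
  + suc k / 1                ≡⟨ cong (λ i → (+ 1 ℤ.+ i) / 1) (ℤ.*-identityʳ (+ k)) ⟨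
  (+ 1 ℤ.+ + k ℤ.* + 1) / 1  ≡⟨⟩
  1ℚ + mkℚ (+ k) 0 k⊥1       ≡⟨ cong (_+_ 1ℚ) (ℚ.normalize-coprime k⊥1) ⟨
  1ℚ + + k / 1               ∎
  where
  open ≡-Reasoning
  k⊥1 : Coprime k 1
  k⊥1 = Coprime-sym (1-coprimeTo k)

∑-const-≤ : ∀ {a} {A : Set a} {c : ℚ} (xs : List A) {k : ℕ} →
            0ℚ ≤ℚ c → length xs ≤ k → ∑ (λ _ → c) xs ≤ℚ (+ k / 1) · c
∑-const-≤ {c = c} []       {k} 0≤c _ =
  ℚ.nonNegative⁻¹ _ {{ℚ.nonNeg*nonNeg⇒nonNeg (+ k / 1) {{ℚ.normalize-nonNeg k 1}} c {{nonNegative 0≤c}}}}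
∑-const-≤ {c = c} (_ ∷ xs) {suc k} 0≤c (s≤s |xs|≤k) = begin
  c + ∑ (λ _ → c) xs          ≤⟨ ℚ.+-monoʳ-≤ c (∑-const-≤ xs 0≤c |xs|≤k) ⟩
  c + (+ k / 1) · c           ≡⟨ cong (_+ (+ k / 1) · c) (ℚ.*-identityˡ c) ⟨
  1ℚ · c + (+ k / 1) · c      ≡⟨ ℚ.*-distribʳ-+ c 1ℚ (+ k / 1) ⟨
  (1ℚ + + k / 1) · c          ≡⟨ cong (_· c) (+suc/1 k) ⟨
  (+ suc k / 1) · c           ∎
  where open ℚ.≤-Reasoning

-- Multilinear polynomials on the cube

𝟙 : Bool → ℚ
𝟙 true  = 1ℚ
𝟙 false = 0ℚ

𝟙-∧ : ∀ a b → 𝟙 (a ∧ b) ≡ 𝟙 a · 𝟙 b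
𝟙-∧ true  b = sym (ℚ.*-identityˡ (𝟙 b))
𝟙-∧ false b = sym (ℚ.*-zeroˡ (𝟙 b))

_⊆ᵇ_ : Subset n → Subset n → Bool
[]      ⊆ᵇ []      = true
(u ∷ U) ⊆ᵇ (b ∷ x) = (if u then b else true) ∧ (U ⊆ᵇ x)

-- A point of the cube {0,1}ⁿ is encoded by the set of its coordinates equal to 1;
-- χ U x is the value of the monomial x_U at x.
χ : Subset n → Subset n → ℚ
χ U x = 𝟙 (U ⊆ᵇ x)

eval : Poly n → Subset n → ℚ
eval {n} p x = ∑ (λ U → p U · χ U x) (allSubsets n)

∑-allSubsets-suc : (f : Subset (suc n) → ℚ) →
  ∑ f (allSubsets (suc n)) ≡ ∑ (λ U → f (true ∷ U)) (allSubsets n) + ∑ (λ U → f (false ∷ U)) (allSubsets n)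
∑-allSubsets-suc {n} f = begin
  ∑ f (map (true ∷_) all ++ map (false ∷_) all)
    ≡⟨ ∑-++ f (map (true ∷_) all) _ ⟩
  ∑ f (map (true ∷_) all) + ∑ f (map (false ∷_) all)
    ≡⟨ cong₂ _+_ (∑-map f (true ∷_) all) (∑-map f (false ∷_) all) ⟩
  ∑ (λ U → f (true ∷ U)) all + ∑ (λ U → f (false ∷ U)) all ∎
  where
  open ≡-Reasoning
  all = allSubsets n

∑-allSubsets-supported : {f : Subset n → ℚ} (V : Subset n) → (∀ U → U ≢ V → f U ≡ 0ℚ) →
                         ∑ f (allSubsets n) ≡ f V
∑-allSubsets-supported []      _ = ℚ.+-identityʳ _
∑-allSubsets-supported {suc n} {f} (true ∷ V) off = begin
  ∑ f (allSubsets (suc n))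
    ≡⟨ ∑-allSubsets-suc f ⟩
  ∑ (λ U → f (true ∷ U)) (allSubsets n) + ∑ (λ U → f (false ∷ U)) (allSubsets n)
    ≡⟨ cong₂ _+_ (∑-allSubsets-supported V (λ U U≢V → off (_ ∷ U) (U≢V ∘ ∷-injectiveʳ)))
                 (∑-zero (λ U → off (_ ∷ U) (λ ())) (allSubsets n)) ⟩
  f (true ∷ V) + 0ℚ
    ≡⟨ ℚ.+-identityʳ _ ⟩
  f (true ∷ V) ∎
  where open ≡-Reasoning
∑-allSubsets-supported {suc n} {f} (false ∷ V) off = begin
  ∑ f (allSubsets (suc n))
    ≡⟨ ∑-allSubsets-suc f ⟩
  ∑ (λ U → f (true ∷ U)) (allSubsets n) + ∑ (λ U → f (false ∷ U)) (allSubsets n)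
    ≡⟨ cong₂ _+_ (∑-zero (λ U → off (_ ∷ U) (λ ())) (allSubsets n))
                 (∑-allSubsets-supported V (λ U U≢V → off (_ ∷ U) (U≢V ∘ ∷-injectiveʳ))) ⟩
  0ℚ + f (false ∷ V)
    ≡⟨ ℚ.+-identityˡ _ ⟩
  f (false ∷ V) ∎
  where open ≡-Reasoning

eval-suc : (p : Poly (suc n)) (b : Bool) (x : Subset n) →
  eval p (b ∷ x) ≡ eval (λ U → p (false ∷ U)) x + 𝟙 b · eval (λ U → p (true ∷ U)) x
eval-suc {n} p b x = begin
  eval p (b ∷ x)
    ≡⟨ ∑-allSubsets-suc (λ U → p U · χ U (b ∷ x)) ⟩
  ∑ (λ U → p (true ∷ U) · 𝟙 (b ∧ (U ⊆ᵇ x))) all + eval p₀ x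
    ≡⟨ cong (_+ eval p₀ x) (∑-cong (λ U → cong (p (true ∷ U) ·_) (𝟙-∧ b (U ⊆ᵇ x))) all) ⟩
  ∑ (λ U → p (true ∷ U) · (𝟙 b · χ U x)) all + eval p₀ x
    ≡⟨ cong (_+ eval p₀ x) (∑-cong (λ U → x∙yz≈y∙xz (p (true ∷ U)) (𝟙 b) (χ U x)) all) ⟩
  ∑ (λ U → 𝟙 b · (p (true ∷ U) · χ U x)) all + eval p₀ x
    ≡⟨ cong (_+ eval p₀ x) (∑-*ˡ (𝟙 b) (λ U → p (true ∷ U) · χ U x) all) ⟩
  𝟙 b · eval p₁ x + eval p₀ x
    ≡⟨ ℚ.+-comm (𝟙 b · eval p₁ x) (eval p₀ x) ⟩
  eval p₀ x + 𝟙 b · eval p₁ x ∎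
  where
  open ≡-Reasoning
  all = allSubsets n
  p₀ p₁ : Poly n
  p₀ U = p (false ∷ U)
  p₁ U = p (true ∷ U)

eval-false : (p : Poly (suc n)) (x : Subset n) → eval p (false ∷ x) ≡ eval (λ U → p (false ∷ U)) x
eval-false p x = trans (eval-suc p false x)
  (trans (cong (_+_ (eval (λ U → p (false ∷ U)) x)) (ℚ.*-zeroˡ (eval (λ U → p (true ∷ U)) x)))
         (ℚ.+-identityʳ _))

eval-true : (p : Poly (suc n)) (x : Subset n) →
  eval p (true ∷ x) ≡ eval (λ U → p (false ∷ U)) x + eval (λ U → p (true ∷ U)) x
eval-true p x = trans (eval-suc p true x)
  (cong (_+_ (eval (λ U → p (false ∷ U)) x)) (ℚ.*-identityˡ (eval (λ U → p (true ∷ U)) x)))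

eval-injective : {p q : Poly n} → (∀ x → eval p x ≡ eval q x) → ∀ U → p U ≡ q U
eval-injective {zero} {p} {q} same [] = begin
  p []        ≡⟨ ℚ.*-identityʳ (p []) ⟨
  p [] · 1ℚ   ≡⟨ ℚ.+-identityʳ _ ⟨
  eval p []   ≡⟨ same [] ⟩
  eval q []   ≡⟨ ℚ.+-identityʳ _ ⟩
  q [] · 1ℚ   ≡⟨ ℚ.*-identityʳ (q []) ⟩
  q []        ∎
  where open ≡-Reasoning
eval-injective {suc n} {p} {q} same = λ where
    (false ∷ U) → eval-injective {p = p₀} {q₀} same₀ U
    (true ∷ U)  → eval-injective {p = p₁} {q₁} same₁ U
  where
  open ≡-Reasoning
  p₀ p₁ q₀ q₁ : Poly n
  p₀ U = p (false ∷ U)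
  p₁ U = p (true ∷ U)
  q₀ U = q (false ∷ U)
  q₁ U = q (true ∷ U)
  same₀ : ∀ x → eval p₀ x ≡ eval q₀ x
  same₀ x = trans (sym (eval-false p x)) (trans (same (false ∷ x)) (eval-false q x))
  same₁ : ∀ x → eval p₁ x ≡ eval q₁ x
  same₁ x = +-cancelˡ (eval p₀ x) (eval p₁ x) (eval q₁ x) (begin
    eval p₀ x + eval p₁ x   ≡⟨ eval-true p x ⟨
    eval p (true ∷ x)       ≡⟨ same (true ∷ x) ⟩
    eval q (true ∷ x)       ≡⟨ eval-true q x ⟩
    eval q₀ x + eval q₁ x   ≡⟨ cong (_+ eval q₁ x) (same₀ x) ⟨
    eval p₀ x + eval q₁ x   ∎)

eval-+ : (p q : Poly n) (x : Subset n) → eval (λ U → p U + q U) x ≡ eval p x + eval q x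
eval-+ {n} p q x = trans (∑-cong (λ U → ℚ.*-distribʳ-+ (χ U x) (p U) (q U)) (allSubsets n))
                         (∑-+ (λ U → p U · χ U x) (λ U → q U · χ U x) (allSubsets n))

eval--P : (p q : Poly n) (x : Subset n) → eval (p -P q) x ≡ eval p x - eval q x
eval--P {n} p q x = trans (eval-+ p (λ U → - q U) x) (cong (_+_ (eval p x)) eval-neg)
  where
  eval-neg : eval (λ U → - q U) x ≡ - eval q x
  eval-neg = trans (∑-cong (λ U → sym (ℚ.neg-distribˡ-* (q U) (χ U x))) (allSubsets n))
                   (∑-neg (λ U → q U · χ U x) (allSubsets n))

eval-IsZero : {p : Poly n} → IsZero p → ∀ x → eval p x ≡ 0ℚ
eval-IsZero {n} p≡0 x = ∑-zero (λ U → trans (cong (_· χ U x) (p≡0 U)) (ℚ.*-zeroˡ (χ U x))) (allSubsets n)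

eval-supported : {p : Poly n} (V : Subset n) → (∀ U → U ≢ V → p U ≡ 0ℚ) →
                 ∀ x → eval p x ≡ p V · χ V x
eval-supported V off x = ∑-allSubsets-supported V
  (λ U U≢V → trans (cong (_· χ U x) (off U U≢V)) (ℚ.*-zeroˡ (χ U x)))

∅⊆ᵇ : (x : Subset n) → ∅ ⊆ᵇ x ≡ true
∅⊆ᵇ []      = refl
∅⊆ᵇ (_ ∷ x) = ∅⊆ᵇ x

⁅⁆⊆ᵇ : (i : Fin n) (x : Subset n) → ⁅ i ⁆ ⊆ᵇ x ≡ lookup x i
⁅⁆⊆ᵇ zero    (b ∷ x) = trans (cong (b ∧_) (∅⊆ᵇ x)) (∧-identityʳ b)
⁅⁆⊆ᵇ (suc i) (_ ∷ x) = ⁅⁆⊆ᵇ i x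

⊆ᵇ-∪ : (A B x : Subset n) → (A ∪ B) ⊆ᵇ x ≡ (A ⊆ᵇ x) ∧ (B ⊆ᵇ x)
⊆ᵇ-∪ []      []      []      = refl
⊆ᵇ-∪ (a ∷ A) (b ∷ B) (c ∷ x) = trans (cong₂ _∧_ (if-∨ a b) (⊆ᵇ-∪ A B x))
  (∧-interchange (if a then c else true) (if b then c else true) (A ⊆ᵇ x) (B ⊆ᵇ x))
  where
  if-∨ : ∀ a b → (if a ∨ b then c else true) ≡ (if a then c else true) ∧ (if b then c else true)
  if-∨ true  true  = sym (∧-idem c)
  if-∨ true  false = sym (∧-identityʳ c)
  if-∨ false b     = refl

eval-oneP : (x : Subset n) → eval oneP x ≡ 1ℚ
eval-oneP {n} x = begin
  eval oneP x               ≡⟨ eval-supported (∅ {n}) oneP-off x ⟩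
  oneP (∅ {n}) · χ ∅ x      ≡⟨ cong₂ (λ c b → c · 𝟙 b) oneP-∅ (∅⊆ᵇ x) ⟩
  1ℚ · 1ℚ               ≡⟨⟩
  1ℚ                    ∎
  where
  open ≡-Reasoning
  oneP-∅ : oneP (∅ {n}) ≡ 1ℚ
  oneP-∅ with ∅ {n} ≟S ∅
  ... | yes _  = refl
  ... | no ∅≢∅ = contradiction refl ∅≢∅
  oneP-off : ∀ U → U ≢ ∅ → oneP {n} U ≡ 0ℚ
  oneP-off U U≢∅ with U ≟S ∅
  ... | yes U≡∅ = contradiction U≡∅ U≢∅
  ... | no _    = refl

eval-varP : (i : Fin n) (x : Subset n) → eval (varP i) x ≡ 𝟙 (lookup x i)
eval-varP i x = begin
  eval (varP i) x         ≡⟨ eval-supported ⁅ i ⁆ varP-off x ⟩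
  varP i ⁅ i ⁆ · χ ⁅ i ⁆ x ≡⟨ cong₂ (λ c b → c · 𝟙 b) varP-⁅⁆ (⁅⁆⊆ᵇ i x) ⟩
  1ℚ · 𝟙 (lookup x i)     ≡⟨ ℚ.*-identityˡ _ ⟩
  𝟙 (lookup x i)          ∎
  where
  open ≡-Reasoning
  varP-⁅⁆ : varP i ⁅ i ⁆ ≡ 1ℚ
  varP-⁅⁆ with ⁅ i ⁆ ≟S ⁅ i ⁆
  ... | yes _  = refl
  ... | no i≢i = contradiction refl i≢i
  varP-off : ∀ U → U ≢ ⁅ i ⁆ → varP i U ≡ 0ℚ
  varP-off U U≢i with U ≟S ⁅ i ⁆
  ... | yes U≡i = contradiction U≡i U≢i
  ... | no _    = refl

-- The summand in the definition of _*P_ is local to it; naming it by unification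
-- lets us replay the case distinction that defines it.
*P-summand : (p q : Poly n) (U : Subset n) →
  Σ[ s ∈ (Subset n → Subset n → ℚ) ] (p *P q) U ≡ ∑ (λ A → ∑ (s A) (allSubsets n)) (allSubsets n)
*P-summand p q U = _ , refl

*P-summand-on : (p q : Poly n) (A B : Subset n) → proj₁ (*P-summand p q (A ∪ B)) A B ≡ p A · q B
*P-summand-on p q A B with (A ∪ B) ≟S (A ∪ B)
... | yes _ = refl
... | no ne = contradiction refl ne

*P-summand-off : (p q : Poly n) (U A B : Subset n) → U ≢ A ∪ B → proj₁ (*P-summand p q U) A B ≡ 0ℚ
*P-summand-off p q U A B ne with (A ∪ B) ≟S U
... | yes eq = contradiction (sym eq) ne
... | no _   = refl

eval-*P : (p q : Poly n) (x : Subset n) → eval (p *P q) x ≡ eval p x · eval q x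
eval-*P {n} p q x = begin
  ∑ (λ U → ∑ (λ A → ∑ (s U A) all) all · χ U x) all
    ≡⟨ ∑-cong (λ U → trans (sym (∑-*ʳ (χ U x) _ all)) (∑-cong (λ A → sym (∑-*ʳ (χ U x) (s U A) all)) all)) all ⟩
  ∑ (λ U → ∑ (λ A → ∑ (λ B → s U A B · χ U x) all) all) all
    ≡⟨ ∑-swap (λ U A → ∑ (λ B → s U A B · χ U x) all) all all ⟩
  ∑ (λ A → ∑ (λ U → ∑ (λ B → s U A B · χ U x) all) all) all
    ≡⟨ ∑-cong (λ A → ∑-swap (λ U B → s U A B · χ U x) all all) all ⟩
  ∑ (λ A → ∑ (λ B → ∑ (λ U → s U A B · χ U x) all) all) all
    ≡⟨ ∑-cong (λ A → ∑-cong (λ B → collapse A B) all) all ⟩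
  ∑ (λ A → ∑ (λ B → (p A · q B) · χ (A ∪ B) x) all) all
    ≡⟨ ∑-cong (λ A → ∑-cong (λ B → factor A B) all) all ⟩
  ∑ (λ A → ∑ (λ B → (p A · χ A x) · (q B · χ B x)) all) all
    ≡⟨ ∑-cong (λ A → ∑-*ˡ (p A · χ A x) (λ B → q B · χ B x) all) all ⟩
  ∑ (λ A → (p A · χ A x) · eval q x) all
    ≡⟨ ∑-*ʳ (eval q x) (λ A → p A · χ A x) all ⟩
  eval p x · eval q x ∎
  where
  open ≡-Reasoning
  all = allSubsets n
  s : Subset n → Subset n → Subset n → ℚ
  s U = proj₁ (*P-summand p q U)
  collapse : ∀ A B → ∑ (λ U → s U A B · χ U x) all ≡ (p A · q B) · χ (A ∪ B) x
  collapse A B = trans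
    (∑-allSubsets-supported (A ∪ B)
      (λ U ne → trans (cong (_· χ U x) (*P-summand-off p q U A B ne)) (ℚ.*-zeroˡ (χ U x))))
    (cong (_· χ (A ∪ B) x) (*P-summand-on p q A B))
  factor : ∀ A B → (p A · q B) · χ (A ∪ B) x ≡ (p A · χ A x) · (q B · χ B x)
  factor A B = trans (cong (p A · q B ·_) (trans (cong 𝟙 (⊆ᵇ-∪ A B x)) (𝟙-∧ (A ⊆ᵇ x) (B ⊆ᵇ x))))
                     (·-interchange (p A) (q B) (χ A x) (χ B x))

∪-lub : {p q r : Subset n} → p ⊆ˢ r → q ⊆ˢ r → p ∪ q ⊆ˢ r
∪-lub {p = p} {q} p⊆r q⊆r i∈p∪q with x∈p∪q⁻ p q i∈p∪q
... | inj₁ i∈p = p⊆r i∈p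
... | inj₂ i∈q = q⊆r i∈q

∪-mono : {p p′ q q′ : Subset n} → p ⊆ˢ p′ → q ⊆ˢ q′ → p ∪ q ⊆ˢ p′ ∪ q′
∪-mono {p′ = p′} {q′ = q′} p⊆p′ q⊆q′ = ∪-lub (⊆-trans p⊆p′ (p⊆p∪q q′)) (⊆-trans q⊆q′ (q⊆p∪q p′ q′))

∣∪∣≤ : (p q : Subset n) → ∣ p ∪ q ∣ ≤ ∣ p ∣ +ℕ ∣ q ∣
∣∪∣≤ []          []          = z≤n
∣∪∣≤ (true ∷ p)  (true ∷ q)  = s≤s (≤-trans (∣∪∣≤ p q) (+-monoʳ-≤ ∣ p ∣ (n≤1+n ∣ q ∣)))
∣∪∣≤ (true ∷ p)  (false ∷ q) = s≤s (∣∪∣≤ p q)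
∣∪∣≤ (false ∷ p) (true ∷ q)  = ≤-trans (s≤s (∣∪∣≤ p q)) (≤-reflexive (sym (+-suc ∣ p ∣ ∣ q ∣)))
∣∪∣≤ (false ∷ p) (false ∷ q) = ∣∪∣≤ p q

∣p∣≤0⇒Empty : {p : Subset n} → ∣ p ∣ ≤ 0 → Empty p
∣p∣≤0⇒Empty ∣p∣≤0 (_ , i∈p) with ≤-trans (x∈p⇒∣p-x∣<∣p∣ i∈p) ∣p∣≤0
... | ()

elements : Subset n → List (Fin n)
elements []          = []
elements (true ∷ p)  = zero ∷ map suc (elements p)
elements (false ∷ p) = map suc (elements p)

length-elements : (p : Subset n) → length (elements p) ≡ ∣ p ∣
length-elements []          = refl
length-elements (true ∷ p)  = cong suc (trans (length-map suc (elements p)) (length-elements p))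
length-elements (false ∷ p) = trans (length-map suc (elements p)) (length-elements p)

∈-elements : {p : Subset n} {i : Fin n} → i ∈ p → i ∈ˡ elements p
∈-elements                 here        = here refl
∈-elements {p = true ∷ p}  (there i∈p) = there (∈-map⁺ suc (∈-elements i∈p))
∈-elements {p = false ∷ p} (there i∈p) = ∈-map⁺ suc (∈-elements i∈p)

-- Conjunctions

infixr 7 _∧ᶜ_
infix 4 _⊑_

_∧ᶜ_ : Conj n → Conj n → Conj n
(S , T) ∧ᶜ (S′ , T′) = S ∪ S′ , T ∪ T′

⊤ᶜ : Conj n
⊤ᶜ = ∅ , ∅

lit⁺ lit⁻ : Fin n → Conj n
lit⁺ v = ⁅ v ⁆ , ∅
lit⁻ v = ∅ , ⁅ v ⁆

-- A ⊑ B: B extends A, hence implies it.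
_⊑_ : Conj n → Conj n → Set
(S , T) ⊑ (S′ , T′) = (S ⊆ˢ S′) × (T ⊆ˢ T′)

vars : Conj n → Subset n
vars (S , T) = S ∪ T

Clash : Conj n → Fin n → Set
Clash (S , T) i = (i ∈ S) × (i ∈ T)

WellFormed? : (C : Conj n) → Dec (WellFormed C)
WellFormed? (S , T) = (S ∩ T) ≟S ∅

WellFormed⇒¬Clash : {C : Conj n} → WellFormed C → ∀ {i} → ¬ Clash C i
WellFormed⇒¬Clash wf clash = ∉⊥ (subst (_ ∈_) wf (x∈p∩q⁺ clash))

¬Clash⇒WellFormed : {C : Conj n} → (∀ {i} → ¬ Clash C i) → WellFormed C
¬Clash⇒WellFormed {C = S , T} noClash = Empty-unique (λ (_ , i∈S∩T) → noClash (x∈p∩q⁻ S T i∈S∩T))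

¬WellFormed⇒Clash : {C : Conj n} → ¬ WellFormed C → ∃ (Clash C)
¬WellFormed⇒Clash {C = S , T} ill with nonempty? (S ∩ T)
... | yes (i , i∈S∩T) = i , x∈p∩q⁻ S T i∈S∩T
... | no  empty       = contradiction (Empty-unique empty) ill

⊑-refl : {A : Conj n} → A ⊑ A
⊑-refl = ⊆-refl , ⊆-refl

⊑-trans : {A B C : Conj n} → A ⊑ B → B ⊑ C → A ⊑ C
⊑-trans (S⊆S′ , T⊆T′) (S′⊆S″ , T′⊆T″) = ⊆-trans S⊆S′ S′⊆S″ , ⊆-trans T⊆T′ T′⊆T″

⊑-∧ᶜˡ : (A B : Conj n) → A ⊑ A ∧ᶜ B
⊑-∧ᶜˡ (S , T) (S′ , T′) = p⊆p∪q S′ , p⊆p∪q T′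

⊑-∧ᶜʳ : (A B : Conj n) → B ⊑ A ∧ᶜ B
⊑-∧ᶜʳ (S , T) (S′ , T′) = q⊆p∪q S S′ , q⊆p∪q T T′

∧ᶜ-mono : {A A′ B B′ : Conj n} → A ⊑ A′ → B ⊑ B′ → A ∧ᶜ B ⊑ A′ ∧ᶜ B′
∧ᶜ-mono (S⊆ , T⊆) (S⊆′ , T⊆′) = ∪-mono S⊆ S⊆′ , ∪-mono T⊆ T⊆′

⊑⇒∧ᶜ-absorb : {A B : Conj n} → A ⊑ B → A ∧ᶜ B ≡ B
⊑⇒∧ᶜ-absorb {A = S , T} {S′ , T′} (S⊆S′ , T⊆T′) =
  cong₂ _,_ (⊆-antisym (∪-lub S⊆S′ ⊆-refl) (q⊆p∪q S S′)) (⊆-antisym (∪-lub T⊆T′ ⊆-refl) (q⊆p∪q T T′))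

∧ᶜ-assoc : (A B C : Conj n) → (A ∧ᶜ B) ∧ᶜ C ≡ A ∧ᶜ (B ∧ᶜ C)
∧ᶜ-assoc (S , T) (S′ , T′) (S″ , T″) = cong₂ _,_ (∪-assoc S S′ S″) (∪-assoc T T′ T″)

∧ᶜ-identityʳ : (A : Conj n) → A ∧ᶜ ⊤ᶜ ≡ A
∧ᶜ-identityʳ (S , T) = cong₂ _,_ (∪-identityʳ S) (∪-identityʳ T)

vars-mono : {A B : Conj n} → A ⊑ B → vars A ⊆ˢ vars B
vars-mono (S⊆S′ , T⊆T′) = ∪-mono S⊆S′ T⊆T′

vars-∧ᶜ : (A B : Conj n) → vars (A ∧ᶜ B) ⊆ˢ vars A ∪ vars B
vars-∧ᶜ (S , T) (S′ , T′) = ∪-lub (∪-mono (p⊆p∪q T) (p⊆p∪q T′)) (∪-mono (q⊆p∪q S T) (q⊆p∪q S′ T′))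

WellFormed-antitone : {A B : Conj n} → A ⊑ B → WellFormed B → WellFormed A
WellFormed-antitone (S⊆S′ , T⊆T′) wf =
  ¬Clash⇒WellFormed (λ (i∈S , i∈T) → WellFormed⇒¬Clash wf (S⊆S′ i∈S , T⊆T′ i∈T))

degree-∧ᶜ : (A B : Conj n) → degree (A ∧ᶜ B) ≤ degree A +ℕ degree B
degree-∧ᶜ (S , T) (S′ , T′) = ≤-trans (+-mono-≤ (∣∪∣≤ S S′) (∣∪∣≤ T T′))
  (≤-reflexive (+-interchange (∣ S ∣) (∣ S′ ∣) (∣ T ∣) (∣ T′ ∣)))

degree-⊤ᶜ : degree (⊤ᶜ {n}) ≡ 0
degree-⊤ᶜ {n} = cong₂ _+ℕ_ (∣⊥∣≡0 n) (∣⊥∣≡0 n)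

degree-lit⁺ : (v : Fin n) → degree (lit⁺ v) ≡ 1
degree-lit⁺ {n} v = cong₂ _+ℕ_ (∣⁅x⁆∣≡1 v) (∣⊥∣≡0 n)

degree-lit⁻ : (v : Fin n) → degree (lit⁻ v) ≡ 1
degree-lit⁻ {n} v = cong₂ _+ℕ_ (∣⊥∣≡0 n) (∣⁅x⁆∣≡1 v)

∣vars∣≤degree : (C : Conj n) → ∣ vars C ∣ ≤ degree C
∣vars∣≤degree (S , T) = ∣∪∣≤ S T

⋀ : List (Conj n) → Conj n
⋀ = foldr _∧ᶜ_ ⊤ᶜ

⋀-upper : (P : List (Conj n)) → All (_⊑ ⋀ P) P
⋀-upper []      = []
⋀-upper (C ∷ P) = ⊑-∧ᶜˡ C (⋀ P) ∷ All.map (λ C′⊑⋀P → ⊑-trans C′⊑⋀P (⊑-∧ᶜʳ C (⋀ P))) (⋀-upper P)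

degree-⋀ : ∀ {d} (P : List (Conj n)) → All (λ C → degree C ≤ d) P → degree (⋀ P) ≤ length P * d
degree-⋀ {n} []      []          = ≤-reflexive (degree-⊤ᶜ {n})
degree-⋀ (C ∷ P) (C≤d ∷ P≤d) = ≤-trans (degree-∧ᶜ C (⋀ P)) (+-mono-≤ C≤d (degree-⋀ P P≤d))

-- permits s t b: whether the value b is allowed at a coordinate carrying the literal x
-- (when s) and the literal 1 - x (when t).
permits : Bool → Bool → Bool → Bool
permits s t b = if b then not t else not s

permits-free : ∀ b → permits false false b ≡ true
permits-free true  = refl
permits-free false = refl

⟦_⟧ : Conj n → Subset n → Bool
⟦ S , T ⟧ x = Vector.foldr _∧_ true (λ i → permits (lookup S i) (lookup T i) (lookup x i))

⟦⟧-∧ᶜ : (A B : Conj n) (x : Subset n) → ⟦ A ∧ᶜ B ⟧ x ≡ ⟦ A ⟧ x ∧ ⟦ B ⟧ x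
⟦⟧-∧ᶜ ([] , []) ([] , []) [] = refl
⟦⟧-∧ᶜ (s ∷ S , t ∷ T) (s′ ∷ S′ , t′ ∷ T′) (b ∷ x) =
  trans (cong₂ _∧_ (permits-∨ b) (⟦⟧-∧ᶜ (S , T) (S′ , T′) x))
        (∧-interchange (permits s t b) (permits s′ t′ b) (⟦ S , T ⟧ x) (⟦ S′ , T′ ⟧ x))
  where
  permits-∨ : ∀ b → permits (s ∨ s′) (t ∨ t′) b ≡ permits s t b ∧ permits s′ t′ b
  permits-∨ true  = deMorgan₂ t t′
  permits-∨ false = deMorgan₂ s s′

⟦⊤ᶜ⟧ : (x : Subset n) → ⟦ ⊤ᶜ ⟧ x ≡ true
⟦⊤ᶜ⟧ []      = refl
⟦⊤ᶜ⟧ (b ∷ x) = trans (cong (_∧ ⟦ ⊤ᶜ ⟧ x) (permits-free b)) (⟦⊤ᶜ⟧ x)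

⟦lit⁺⟧ : (v : Fin n) (x : Subset n) → ⟦ lit⁺ v ⟧ x ≡ lookup x v
⟦lit⁺⟧ zero    (true ∷ x)  = ⟦⊤ᶜ⟧ x
⟦lit⁺⟧ zero    (false ∷ x) = refl
⟦lit⁺⟧ (suc v) (b ∷ x)     = trans (cong (_∧ ⟦ lit⁺ v ⟧ x) (permits-free b)) (⟦lit⁺⟧ v x)

⟦lit⁻⟧ : (v : Fin n) (x : Subset n) → ⟦ lit⁻ v ⟧ x ≡ not (lookup x v)
⟦lit⁻⟧ zero    (true ∷ x)  = refl
⟦lit⁻⟧ zero    (false ∷ x) = ⟦⊤ᶜ⟧ x
⟦lit⁻⟧ (suc v) (b ∷ x)     = trans (cong (_∧ ⟦ lit⁻ v ⟧ x) (permits-free b)) (⟦lit⁻⟧ v x)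

⟦⟧-clash : {C : Conj n} {i : Fin n} → Clash C i → ∀ x → ⟦ C ⟧ x ≡ false
⟦⟧-clash (here , here) (true ∷ x)  = refl
⟦⟧-clash (here , here) (false ∷ x) = refl
⟦⟧-clash {C = s ∷ S , t ∷ T} (there i∈S , there i∈T) (b ∷ x) =
  trans (cong (permits s t b ∧_) (⟦⟧-clash (i∈S , i∈T) x)) (∧-zeroʳ (permits s t b))

⟦⟧-positives : (C : Conj n) → WellFormed C → ⟦ C ⟧ (proj₁ C) ≡ true
⟦⟧-positives ([] , [])              _  = refl
⟦⟧-positives (true ∷ S , true ∷ T)  wf = contradiction (∷-injectiveˡ wf) (λ ())
⟦⟧-positives (true ∷ S , false ∷ T) wf = ⟦⟧-positives (S , T) (∷-injectiveʳ wf)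
⟦⟧-positives (false ∷ S , t ∷ T)    wf = ⟦⟧-positives (S , T) (∷-injectiveʳ wf)

⟦⟧-antitone : {A B : Conj n} → A ⊑ B → ∀ x → ⟦ B ⟧ x ≡ true → ⟦ A ⟧ x ≡ true
⟦⟧-antitone {A = A} {B} A⊑B x ⟦B⟧x = ∧-conicalˡ (⟦ A ⟧ x) (⟦ B ⟧ x) (begin
  ⟦ A ⟧ x ∧ ⟦ B ⟧ x  ≡⟨ ⟦⟧-∧ᶜ A B x ⟨
  ⟦ A ∧ᶜ B ⟧ x       ≡⟨ cong (λ C → ⟦ C ⟧ x) (⊑⇒∧ᶜ-absorb A⊑B) ⟩
  ⟦ B ⟧ x            ≡⟨ ⟦B⟧x ⟩
  true               ∎)
  where open ≡-Reasoning

literalFactor : Subset n → Subset n → Fin n → Poly n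
literalFactor S T i = (if lookup S i then varP i else oneP) *P (if lookup T i then (oneP -P varP i) else oneP)

eval-literalFactor : (S T : Subset n) (i : Fin n) (x : Subset n) →
  eval (literalFactor S T i) x ≡ 𝟙 (permits (lookup S i) (lookup T i) (lookup x i))
eval-literalFactor S T i x = begin
  eval (literalFactor S T i) x
    ≡⟨ eval-*P _ _ x ⟩
  eval (if lookup S i then varP i else oneP) x · eval (if lookup T i then (oneP -P varP i) else oneP) x
    ≡⟨ cong₂ _·_ (eval-positive (lookup S i)) (eval-negative (lookup T i)) ⟩
  (if lookup S i then 𝟙 b else 1ℚ) · (if lookup T i then 1ℚ - 𝟙 b else 1ℚ)
    ≡⟨ values (lookup S i) (lookup T i) b ⟩
  𝟙 (permits (lookup S i) (lookup T i) b) ∎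
  where
  open ≡-Reasoning
  b = lookup x i
  eval-positive : ∀ s → eval (if s then varP i else oneP) x ≡ (if s then 𝟙 b else 1ℚ)
  eval-positive true  = eval-varP i x
  eval-positive false = eval-oneP x
  eval-negative : ∀ t → eval (if t then (oneP -P varP i) else oneP) x ≡ (if t then 1ℚ - 𝟙 b else 1ℚ)
  eval-negative true  = trans (eval--P oneP (varP i) x) (cong₂ _-_ (eval-oneP x) (eval-varP i x))
  eval-negative false = eval-oneP x
  values : ∀ s t b → (if s then 𝟙 b else 1ℚ) · (if t then 1ℚ - 𝟙 b else 1ℚ) ≡ 𝟙 (permits s t b)
  values true  true  true  = refl
  values true  true  false = refl
  values true  false true  = refl
  values true  false false = refl
  values false true  true  = refl
  values false true  false = refl
  values false false true  = refl
  values false false false = refl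

eval-prodP-tabulate : ∀ {m} (f : Fin m → Poly n) (g : Fin m → Bool) (x : Subset n) →
  (∀ i → eval (f i) x ≡ 𝟙 (g i)) → eval (prodP (tabulate f)) x ≡ 𝟙 (Vector.foldr _∧_ true g)
eval-prodP-tabulate {m = zero}  f g x _   = eval-oneP x
eval-prodP-tabulate {m = suc m} f g x f≡g = begin
  eval (f zero *P prodP (tabulate (f ∘ suc))) x
    ≡⟨ eval-*P (f zero) _ x ⟩
  eval (f zero) x · eval (prodP (tabulate (f ∘ suc))) x
    ≡⟨ cong₂ _·_ (f≡g zero) (eval-prodP-tabulate (f ∘ suc) (g ∘ suc) x (f≡g ∘ suc)) ⟩
  𝟙 (g zero) · 𝟙 (Vector.foldr _∧_ true (g ∘ suc))
    ≡⟨ 𝟙-∧ (g zero) _ ⟨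
  𝟙 (Vector.foldr _∧_ true g) ∎
  where open ≡-Reasoning

eval-conjP : (C : Conj n) (x : Subset n) → eval (conjP C) x ≡ 𝟙 (⟦ C ⟧ x)
eval-conjP {n} (S , T) x = begin
  eval (prodP (map (literalFactor S T) (allFin n))) x
    ≡⟨ cong (λ ps → eval (prodP ps) x) (map-tabulate (λ i → i) (literalFactor S T)) ⟩
  eval (prodP (tabulate (literalFactor S T))) x
    ≡⟨ eval-prodP-tabulate (literalFactor S T) _ x (λ i → eval-literalFactor S T i x) ⟩
  𝟙 (⟦ S , T ⟧ x) ∎
  where open ≡-Reasoning

eval-prodP-satisfied : (𝒮 : List (Conj n)) (x : Subset n) → All (λ C → ⟦ C ⟧ x ≡ true) 𝒮 →
                       eval (prodP (map conjP 𝒮)) x ≡ 1ℚ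
eval-prodP-satisfied []      x []            = eval-oneP x
eval-prodP-satisfied (C ∷ 𝒮) x (sat ∷ 𝒮-sat) = begin
  eval (conjP C *P prodP (map conjP 𝒮)) x          ≡⟨ eval-*P (conjP C) _ x ⟩
  eval (conjP C) x · eval (prodP (map conjP 𝒮)) x  ≡⟨ cong₂ _·_ (trans (eval-conjP C x) (cong 𝟙 sat))
                                                                (eval-prodP-satisfied 𝒮 x 𝒮-sat) ⟩
  1ℚ · 1ℚ                                          ≡⟨⟩
  1ℚ                                               ∎
  where open ≡-Reasoning

-- Free variables and maximal consistent extensions

free : Conj n → Conj n → Subset n
free C ρ = vars C ∩ ∁ (vars ρ)

∈-free⁻ : {C ρ : Conj n} {i : Fin n} → i ∈ free C ρ → i ∈ vars C × i ∉ vars ρ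
∈-free⁻ {C = C} {ρ} i∈ with x∈p∩q⁻ (vars C) (∁ (vars ρ)) i∈
... | i∈C , i∈∁ρ = i∈C , x∈∁p⇒x∉p i∈∁ρ

∈-free⁺ : {C ρ : Conj n} {i : Fin n} → i ∈ vars C → i ∉ vars ρ → i ∈ free C ρ
∈-free⁺ i∈C i∉ρ = x∈p∩q⁺ (i∈C , x∉p⇒x∈∁p i∉ρ)

free-antitone : {C ρ ρ′ : Conj n} → ρ ⊑ ρ′ → free C ρ′ ⊆ˢ free C ρ
free-antitone ρ⊑ρ′ i∈ with ∈-free⁻ i∈
... | i∈C , i∉ρ′ = ∈-free⁺ i∈C (i∉ρ′ ∘ vars-mono ρ⊑ρ′)

free-shrinks : {C ρ ρ′ : Conj n} {i : Fin n} → ρ ⊑ ρ′ → i ∈ free C ρ → i ∈ vars ρ′ →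
               ∣ free C ρ′ ∣ < ∣ free C ρ ∣
free-shrinks ρ⊑ρ′ i∈free i∈ρ′ =
  p⊂q⇒∣p∣<∣q∣ (free-antitone ρ⊑ρ′ , _ , i∈free , λ i∈free′ → proj₂ (∈-free⁻ i∈free′) i∈ρ′)

free-decreases : {C ρ ρ′ : Conj n} {k : ℕ} → ρ ⊑ ρ′ → ∣ free C ρ ∣ ≤ suc k →
                 Empty (free C ρ) ⊎ ∃[ i ] (i ∈ free C ρ × i ∈ vars ρ′) → ∣ free C ρ′ ∣ ≤ k
free-decreases {n} {C} {ρ} {ρ′} ρ⊑ρ′ _ (inj₁ empty) = begin
  ∣ free C ρ′ ∣  ≤⟨ p⊆q⇒∣p∣≤∣q∣ (free-antitone {C = C} ρ⊑ρ′) ⟩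
  ∣ free C ρ ∣   ≡⟨ cong ∣_∣ (Empty-unique empty) ⟩
  ∣ ∅ {n} ∣      ≡⟨ ∣⊥∣≡0 n ⟩
  0              ≤⟨ z≤n ⟩
  _              ∎
  where open ≤-Reasoning
free-decreases {C = C} ρ⊑ρ′ bound (inj₂ (_ , i∈free , i∈ρ′)) =
  ≤-pred (≤-trans (free-shrinks {C = C} ρ⊑ρ′ i∈free i∈ρ′) bound)

no-free⇒⊑ : {C ρ : Conj n} → WellFormed (C ∧ᶜ ρ) → Empty (free C ρ) → C ⊑ ρ
no-free⇒⊑ {C = S , T} {ρ = S′ , T′} wf empty = positive-fixed , negative-fixed
  where
  fixed : ∀ {i} → i ∈ S ∪ T → i ∈ S′ ∪ T′
  fixed {i} i∈C with i ∈? (S′ ∪ T′)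
  ... | yes i∈ρ = i∈ρ
  ... | no  i∉ρ = contradiction (i , ∈-free⁺ {C = S , T} {ρ = S′ , T′} i∈C i∉ρ) empty
  positive-fixed : S ⊆ˢ S′
  positive-fixed i∈S with x∈p∪q⁻ S′ T′ (fixed (p⊆p∪q T i∈S))
  ... | inj₁ i∈S′ = i∈S′
  ... | inj₂ i∈T′ = contradiction (p⊆p∪q S′ i∈S , q⊆p∪q T T′ i∈T′) (WellFormed⇒¬Clash wf)
  negative-fixed : T ⊆ˢ T′
  negative-fixed i∈T with x∈p∪q⁻ S′ T′ (fixed (q⊆p∪q S T i∈T))
  ... | inj₁ i∈S′ = contradiction (q⊆p∪q S S′ i∈S′ , p⊆p∪q T′ i∈T) (WellFormed⇒¬Clash wf)
  ... | inj₂ i∈T′ = i∈T′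

clash-is-free : {C ρ J : Conj n} {i : Fin n} → ρ ⊑ J → WellFormed J → WellFormed (C ∧ᶜ ρ) →
                Clash (J ∧ᶜ C) i → i ∈ free C ρ × i ∈ vars J
clash-is-free {C = S , T} {Sρ , Tρ} {SJ , TJ} (Sρ⊆SJ , Tρ⊆TJ) wfJ wfCρ (i∈SJ∪S , i∈TJ∪T)
  with x∈p∪q⁻ SJ S i∈SJ∪S | x∈p∪q⁻ TJ T i∈TJ∪T
... | inj₁ i∈SJ | inj₁ i∈TJ = contradiction (i∈SJ , i∈TJ) (WellFormed⇒¬Clash wfJ)
... | inj₂ i∈S  | inj₂ i∈T  = contradiction (p⊆p∪q Sρ i∈S , p⊆p∪q Tρ i∈T) (WellFormed⇒¬Clash wfCρ)
... | inj₁ i∈SJ | inj₂ i∈T  = ∈-free⁺ {C = S , T} {Sρ , Tρ} (q⊆p∪q S T i∈T) i∉ρ , p⊆p∪q TJ i∈SJ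
  where
  i∉ρ : _ ∉ Sρ ∪ Tρ
  i∉ρ i∈ρ with x∈p∪q⁻ Sρ Tρ i∈ρ
  ... | inj₁ i∈Sρ = WellFormed⇒¬Clash wfCρ (q⊆p∪q S Sρ i∈Sρ , p⊆p∪q Tρ i∈T)
  ... | inj₂ i∈Tρ = WellFormed⇒¬Clash wfJ (i∈SJ , Tρ⊆TJ i∈Tρ)
... | inj₂ i∈S  | inj₁ i∈TJ = ∈-free⁺ {C = S , T} {Sρ , Tρ} (p⊆p∪q T i∈S) i∉ρ , q⊆p∪q SJ TJ i∈TJ
  where
  i∉ρ : _ ∉ Sρ ∪ Tρ
  i∉ρ i∈ρ with x∈p∪q⁻ Sρ Tρ i∈ρ
  ... | inj₁ i∈Sρ = WellFormed⇒¬Clash wfJ (Sρ⊆SJ i∈Sρ , i∈TJ)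
  ... | inj₂ i∈Tρ = WellFormed⇒¬Clash wfCρ (p⊆p∪q Sρ i∈S , q⊆p∪q T Tρ i∈Tρ)

Settled : Conj n → Conj n → Set
Settled J C = C ⊑ J ⊎ ¬ WellFormed (J ∧ᶜ C)

settled⇒free-in-vars : {C ρ J : Conj n} → ρ ⊑ J → WellFormed J → WellFormed (C ∧ᶜ ρ) → Settled J C →
                       Empty (free C ρ) ⊎ ∃[ i ] (i ∈ free C ρ × i ∈ vars J)
settled⇒free-in-vars {C = C} {ρ} _ _ _ (inj₁ C⊑J) with nonempty? (free C ρ)
... | no  empty        = inj₁ empty
... | yes (i , i∈free) = inj₂ (i , i∈free , vars-mono C⊑J (proj₁ (∈-free⁻ i∈free)))
settled⇒free-in-vars ρ⊑J wfJ wfCρ (inj₂ ill) with ¬WellFormed⇒Clash ill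
... | i , clash = inj₂ (i , clash-is-free ρ⊑J wfJ wfCρ clash)

record MaximalIn (G : List (Conj n)) (J : Conj n) : Set where
  field
    consistent : WellFormed J
    settles    : All (Settled J) G

open MaximalIn

greedy : (G : List (Conj n)) (J : Conj n) → WellFormed J →
         Σ[ P ∈ List (Conj n) ] (P ⊆ G × MaximalIn G (J ∧ᶜ ⋀ P))
greedy []      J wf = [] , [] , record { consistent = subst WellFormed (sym (∧ᶜ-identityʳ J)) wf ; settles = [] }
greedy (C ∷ G) J wf with WellFormed? (J ∧ᶜ C)
... | yes wf′ with greedy G (J ∧ᶜ C) wf′
...   | P , P⊆G , maximal = C ∷ P , refl ∷ P⊆G , add-C (subst (MaximalIn G) (∧ᶜ-assoc J C (⋀ P)) maximal)
  where
  add-C : MaximalIn G (J ∧ᶜ ⋀ (C ∷ P)) → MaximalIn (C ∷ G) (J ∧ᶜ ⋀ (C ∷ P))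
  add-C m = record
    { consistent = consistent m
    ; settles    = inj₁ (⊑-trans (⊑-∧ᶜˡ C (⋀ P)) (⊑-∧ᶜʳ J (⋀ (C ∷ P)))) ∷ settles m }
greedy (C ∷ G) J wf | no ill with greedy G J wf
... | P , P⊆G , maximal = P , C ∷ʳ P⊆G , record
  { consistent = consistent maximal
  ; settles    = inj₂ (ill ∘ WellFormed-antitone (∧ᶜ-mono (⊑-∧ᶜˡ J (⋀ P)) ⊑-refl)) ∷ settles maximal }

module _ {n D : ℕ} (E : PseudoExpectation n D) where

  open PseudoExpectation E

  Ẽ-cong-eval : {p q : Poly n} → (∀ x → eval p x ≡ eval q x) → Ẽ[ E ] p ≡ Ẽ[ E ] q
  Ẽ-cong-eval {p} {q} same = ∑-cong (λ U → cong (_· L U) (eval-injective {p = p} {q} same U)) (allSubsets n)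

  Ẽ-+ : (p q : Poly n) → Ẽ[ E ] (λ U → p U + q U) ≡ Ẽ[ E ] p + Ẽ[ E ] q
  Ẽ-+ p q = trans (∑-cong (λ U → ℚ.*-distribʳ-+ (L U) (p U) (q U)) (allSubsets n))
                  (∑-+ (λ U → p U · L U) (λ U → q U · L U) (allSubsets n))

  Ẽᶜ : Conj n → ℚ
  Ẽᶜ C = Ẽ[ E ] (conjP C)

  Ẽᶜ-⊤ᶜ : Ẽᶜ ⊤ᶜ ≡ 1ℚ
  Ẽᶜ-⊤ᶜ = trans (Ẽ-cong-eval {p = conjP ⊤ᶜ} {q = oneP} top) normalized
    where
    top : ∀ x → eval (conjP ⊤ᶜ) x ≡ eval oneP x
    top x = trans (eval-conjP ⊤ᶜ x) (trans (cong 𝟙 (⟦⊤ᶜ⟧ x)) (sym (eval-oneP x)))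

  Ẽᶜ-inconsistent : {C : Conj n} → ¬ WellFormed C → Ẽᶜ C ≡ 0ℚ
  Ẽᶜ-inconsistent {C} ill with ¬WellFormed⇒Clash ill
  ... | _ , clash = trans (Ẽ-cong-eval {p = conjP C} {q = λ _ → 0ℚ} vanishes)
                          (∑-zero (λ U → ℚ.*-zeroˡ (L U)) (allSubsets n))
    where
    vanishes : ∀ x → eval (conjP C) x ≡ eval (λ _ → 0ℚ) x
    vanishes x = trans (eval-conjP C x)
      (trans (cong 𝟙 (⟦⟧-clash clash x)) (sym (eval-IsZero (λ _ → refl) x)))

  Ẽᶜ-split : (A : Conj n) (v : Fin n) → Ẽᶜ A ≡ Ẽᶜ (A ∧ᶜ lit⁺ v) + Ẽᶜ (A ∧ᶜ lit⁻ v)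
  Ẽᶜ-split A v = trans (Ẽ-cong-eval {p = conjP A} {q = λ U → conjP A⁺ U + conjP A⁻ U} branches)
                       (Ẽ-+ (conjP A⁺) (conjP A⁻))
    where
    open ≡-Reasoning
    A⁺ A⁻ : Conj n
    A⁺ = A ∧ᶜ lit⁺ v
    A⁻ = A ∧ᶜ lit⁻ v
    𝟙-split : ∀ a b → 𝟙 a ≡ 𝟙 (a ∧ b) + 𝟙 (a ∧ not b)
    𝟙-split true  true  = refl
    𝟙-split true  false = refl
    𝟙-split false _     = refl
    branches : ∀ x → eval (conjP A) x ≡ eval (λ U → conjP A⁺ U + conjP A⁻ U) x
    branches x = begin
      eval (conjP A) x
        ≡⟨ eval-conjP A x ⟩
      𝟙 (⟦ A ⟧ x)
        ≡⟨ 𝟙-split (⟦ A ⟧ x) (lookup x v) ⟩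
      𝟙 (⟦ A ⟧ x ∧ lookup x v) + 𝟙 (⟦ A ⟧ x ∧ not (lookup x v))
        ≡⟨ cong₂ (λ a b → 𝟙 (⟦ A ⟧ x ∧ a) + 𝟙 (⟦ A ⟧ x ∧ b)) (⟦lit⁺⟧ v x) (⟦lit⁻⟧ v x) ⟨
      𝟙 (⟦ A ⟧ x ∧ ⟦ lit⁺ v ⟧ x) + 𝟙 (⟦ A ⟧ x ∧ ⟦ lit⁻ v ⟧ x)
        ≡⟨ cong₂ (λ a b → 𝟙 a + 𝟙 b) (⟦⟧-∧ᶜ A (lit⁺ v) x) (⟦⟧-∧ᶜ A (lit⁻ v) x) ⟨
      𝟙 (⟦ A⁺ ⟧ x) + 𝟙 (⟦ A⁻ ⟧ x)
        ≡⟨ cong₂ _+_ (eval-conjP A⁺ x) (eval-conjP A⁻ x) ⟨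
      eval (conjP A⁺) x + eval (conjP A⁻) x
        ≡⟨ eval-+ (conjP A⁺) (conjP A⁻) x ⟨
      eval (λ U → conjP A⁺ U + conjP A⁻ U) x ∎

  ∑-Ẽᶜ-implied : (ρ : Conj n) (G : List (Conj n)) → All (λ C → WellFormed (C ∧ᶜ ρ) → C ⊑ ρ) G →
    Σ[ P ∈ List (Conj n) ] (P ⊆ G × All (_⊑ ρ) P × ∑ (λ C → Ẽᶜ (C ∧ᶜ ρ)) G ≡ ∑ (λ _ → Ẽᶜ ρ) P)
  ∑-Ẽᶜ-implied ρ []      []           = [] , [] , [] , refl
  ∑-Ẽᶜ-implied ρ (C ∷ G) (imp ∷ imps) with ∑-Ẽᶜ-implied ρ G imps | WellFormed? (C ∧ᶜ ρ)
  ... | P , P⊆G , P⊑ρ , sum≡ | yes wf =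
    C ∷ P , refl ∷ P⊆G , imp wf ∷ P⊑ρ , cong₂ _+_ (cong Ẽᶜ (⊑⇒∧ᶜ-absorb (imp wf))) sum≡
  ... | P , P⊆G , P⊑ρ , sum≡ | no ill =
    P , C ∷ʳ P⊆G , P⊑ρ , trans (cong₂ _+_ (Ẽᶜ-inconsistent ill) sum≡) (ℚ.+-identityˡ _)

-- The decision tree

degree-after-round : ∀ {a b l m k D} → b ≤ a +ℕ l → l ≤ m → a +ℕ m * suc k ≤ D → b +ℕ m * k ≤ D
degree-after-round {a} {b} {l} {m} {k} {D} b≤a+l l≤m a+m[1+k]≤D = begin
  b +ℕ m * k          ≤⟨ +-monoˡ-≤ (m * k) (≤-trans b≤a+l (+-monoʳ-≤ a l≤m)) ⟩
  a +ℕ m +ℕ m * k     ≡⟨ +-assoc a m (m * k) ⟩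
  a +ℕ (m +ℕ m * k)   ≡⟨ cong (a +ℕ_) (*-suc m k) ⟨
  a +ℕ m * suc k      ≤⟨ a+m[1+k]≤D ⟩
  D                   ∎
  where open ≤-Reasoning

module _ {n t d D : ℕ} (F : List (Conj n)) (degree≤d : All (λ C → degree C ≤ d) F)
         (t-wise-inconsistent : ∀ 𝒮 → 𝒮 ⊆ F → length 𝒮 ≡ t → IsZero (prodP (map conjP 𝒮)))
         (E : PseudoExpectation n D) where

  implied-subfamily-bound : (P : List (Conj n)) → P ⊆ F → (J : Conj n) → WellFormed J → All (_⊑ J) P →
                            length P ≤ t ∸ 1
  implied-subfamily-bound P P⊆F J wfJ P⊑J with t ≤? length P
  ... | no  t≰|P| = ∸-monoˡ-≤ 1 (≰⇒> t≰|P|)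
  ... | yes t≤|P| = contradiction (trans (sym product-is-one) product-is-zero) (λ ())
    where
    𝒮 = take t P
    product-is-zero : eval (prodP (map conjP 𝒮)) (proj₁ J) ≡ 0ℚ
    product-is-zero = eval-IsZero (t-wise-inconsistent 𝒮 (⊆ˡ-trans (take-⊆ t P) P⊆F)
                                    (trans (length-take t P) (m≤n⇒m⊓n≡m t≤|P|))) (proj₁ J)
    product-is-one : eval (prodP (map conjP 𝒮)) (proj₁ J) ≡ 1ℚ
    product-is-one = eval-prodP-satisfied 𝒮 (proj₁ J)
      (All.map (λ C⊑J → ⟦⟧-antitone C⊑J (proj₁ J) (⟦⟧-positives J wfJ)) (All-resp-⊆ (take-⊆ t P) P⊑J))

  K : ℚ
  K = + (t ∸ 1) / 1

  BoundedAt : Conj n → Set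
  BoundedAt ρ = ∑ (λ C → Ẽᶜ E (C ∧ᶜ ρ)) F ≤ℚ K · Ẽᶜ E ρ

  bounded-inconsistent : {ρ : Conj n} → ¬ WellFormed ρ → BoundedAt ρ
  bounded-inconsistent {ρ} ill = ℚ.≤-reflexive (begin
    ∑ (λ C → Ẽᶜ E (C ∧ᶜ ρ)) F  ≡⟨ ∑-zero (λ C → Ẽᶜ-inconsistent E (ill ∘ WellFormed-antitone (⊑-∧ᶜʳ C ρ))) F ⟩
    0ℚ                         ≡⟨ ℚ.*-zeroʳ K ⟨
    K · 0ℚ                     ≡⟨ cong (K ·_) (Ẽᶜ-inconsistent E ill) ⟨
    K · Ẽᶜ E ρ                 ∎)
    where open ≡-Reasoning

  bounded-leaf : {ρ : Conj n} → WellFormed ρ → degree ρ ≤ D → All (λ C → WellFormed (C ∧ᶜ ρ) → C ⊑ ρ) F →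
                 BoundedAt ρ
  bounded-leaf {ρ} wf deg implied with ∑-Ẽᶜ-implied E ρ F implied
  ... | P , P⊆F , P⊑ρ , sum≡ = begin
    ∑ (λ C → Ẽᶜ E (C ∧ᶜ ρ)) F  ≡⟨ sum≡ ⟩
    ∑ (λ _ → Ẽᶜ E ρ) P
      ≤⟨ ∑-const-≤ P (PseudoExpectation.nonneg E ρ wf deg) (implied-subfamily-bound P P⊆F ρ wf P⊑ρ) ⟩
    K · Ẽᶜ E ρ                 ∎
    where open ℚ.≤-Reasoning

  bounded-split : (ρ : Conj n) (v : Fin n) → BoundedAt (ρ ∧ᶜ lit⁺ v) → BoundedAt (ρ ∧ᶜ lit⁻ v) → BoundedAt ρ
  bounded-split ρ v bounded⁺ bounded⁻ = begin
    ∑ (λ C → Ẽᶜ E (C ∧ᶜ ρ)) F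
      ≡⟨ ∑-cong split F ⟩
    ∑ (λ C → Ẽᶜ E (C ∧ᶜ ρ⁺) + Ẽᶜ E (C ∧ᶜ ρ⁻)) F
      ≡⟨ ∑-+ (λ C → Ẽᶜ E (C ∧ᶜ ρ⁺)) (λ C → Ẽᶜ E (C ∧ᶜ ρ⁻)) F ⟩
    ∑ (λ C → Ẽᶜ E (C ∧ᶜ ρ⁺)) F + ∑ (λ C → Ẽᶜ E (C ∧ᶜ ρ⁻)) F
      ≤⟨ ℚ.+-mono-≤ bounded⁺ bounded⁻ ⟩
    K · Ẽᶜ E ρ⁺ + K · Ẽᶜ E ρ⁻
      ≡⟨ ℚ.*-distribˡ-+ K (Ẽᶜ E ρ⁺) (Ẽᶜ E ρ⁻) ⟨
    K · (Ẽᶜ E ρ⁺ + Ẽᶜ E ρ⁻)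
      ≡⟨ cong (K ·_) (Ẽᶜ-split E ρ v) ⟨
    K · Ẽᶜ E ρ ∎
    where
    open ℚ.≤-Reasoning
    ρ⁺ ρ⁻ : Conj n
    ρ⁺ = ρ ∧ᶜ lit⁺ v
    ρ⁻ = ρ ∧ᶜ lit⁻ v
    split : ∀ C → Ẽᶜ E (C ∧ᶜ ρ) ≡ Ẽᶜ E (C ∧ᶜ ρ⁺) + Ẽᶜ E (C ∧ᶜ ρ⁻)
    split C = trans (Ẽᶜ-split E (C ∧ᶜ ρ) v)
                    (cong₂ _+_ (cong (Ẽᶜ E) (∧ᶜ-assoc C ρ (lit⁺ v))) (cong (Ẽᶜ E) (∧ᶜ-assoc C ρ (lit⁻ v))))

  decision-tree : (vs : List (Fin n)) (ρ : Conj n) →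
    (∀ ρ′ → ρ ⊑ ρ′ → All (_∈ vars ρ′) vs → degree ρ′ ≤ degree ρ +ℕ length vs → BoundedAt ρ′) →
    BoundedAt ρ
  decision-tree []       ρ leaf = leaf ρ ⊑-refl [] (≤-reflexive (sym (+-identityʳ (degree ρ))))
  decision-tree (v ∷ vs) ρ leaf = bounded-split ρ v
    (branch (lit⁺ v) (degree-lit⁺ v) (x∈p∪q⁺ (inj₁ (x∈⁅x⁆ v))))
    (branch (lit⁻ v) (degree-lit⁻ v) (x∈p∪q⁺ (inj₂ (x∈⁅x⁆ v))))
    where
    branch : (ℓ : Conj n) → degree ℓ ≡ 1 → v ∈ vars ℓ → BoundedAt (ρ ∧ᶜ ℓ)
    branch ℓ deg-ℓ v∈ℓ = decision-tree vs (ρ ∧ᶜ ℓ) λ ρ′ ρℓ⊑ρ′ fixed deg′ →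
      leaf ρ′ (⊑-trans (⊑-∧ᶜˡ ρ ℓ) ρℓ⊑ρ′) (vars-mono (⊑-trans (⊑-∧ᶜʳ ρ ℓ) ρℓ⊑ρ′) v∈ℓ ∷ fixed) (begin
        degree ρ′                          ≤⟨ deg′ ⟩
        degree (ρ ∧ᶜ ℓ) +ℕ length vs       ≤⟨ +-monoˡ-≤ (length vs) (degree-∧ᶜ ρ ℓ) ⟩
        degree ρ +ℕ degree ℓ +ℕ length vs  ≡⟨ cong (λ k → degree ρ +ℕ k +ℕ length vs) deg-ℓ ⟩
        degree ρ +ℕ 1 +ℕ length vs         ≡⟨ +-assoc (degree ρ) 1 (length vs) ⟩
        degree ρ +ℕ suc (length vs)        ∎)
      where open ≤-Reasoning

  -- One round of branching fixes the at most (t-1)d variables of a greedily chosen subfamily.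
  m : ℕ
  m = (t ∸ 1) * d

  Width : ℕ → Conj n → Set
  Width k ρ = All (λ C → WellFormed (C ∧ᶜ ρ) → ∣ free C ρ ∣ ≤ k) F

  chosen-vars-bound : (ρ : Conj n) (P : List (Conj n)) → P ⊆ F → WellFormed (ρ ∧ᶜ ⋀ P) → ∣ vars (⋀ P) ∣ ≤ m
  chosen-vars-bound ρ P P⊆F wf = begin
    ∣ vars (⋀ P) ∣  ≤⟨ ∣vars∣≤degree (⋀ P) ⟩
    degree (⋀ P)    ≤⟨ degree-⋀ P (All-resp-⊆ P⊆F degree≤d) ⟩
    length P * d    ≤⟨ *-monoˡ-≤ d |P|≤t-1 ⟩
    m               ∎
    where
    open ≤-Reasoning
    |P|≤t-1 : length P ≤ t ∸ 1
    |P|≤t-1 = implied-subfamily-bound P P⊆F (ρ ∧ᶜ ⋀ P) wf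
      (All.map (λ C⊑⋀P → ⊑-trans C⊑⋀P (⊑-∧ᶜʳ ρ (⋀ P))) (⋀-upper P))

  width-decreases : ∀ {k} (ρ : Conj n) (P : List (Conj n)) → MaximalIn F (ρ ∧ᶜ ⋀ P) →
                    ∀ {ρ′} → ρ ⊑ ρ′ → vars (⋀ P) ⊆ˢ vars ρ′ → Width (suc k) ρ → Width k ρ′
  width-decreases {k} ρ P maximal {ρ′} ρ⊑ρ′ ⋀P-fixed width = All.zipWith shrink (settles maximal , width)
    where
    fixed : ∀ {i} → i ∈ vars (ρ ∧ᶜ ⋀ P) → i ∉ vars ρ → i ∈ vars ρ′
    fixed i∈J i∉ρ with x∈p∪q⁻ (vars ρ) (vars (⋀ P)) (vars-∧ᶜ ρ (⋀ P) i∈J)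
    ... | inj₁ i∈ρ  = contradiction i∈ρ i∉ρ
    ... | inj₂ i∈⋀P = ⋀P-fixed i∈⋀P
    shrink : ∀ {C} → Settled (ρ ∧ᶜ ⋀ P) C × (WellFormed (C ∧ᶜ ρ) → ∣ free C ρ ∣ ≤ suc k) →
             WellFormed (C ∧ᶜ ρ′) → ∣ free C ρ′ ∣ ≤ k
    shrink {C} (settled , free≤) wf′ = free-decreases {C = C} ρ⊑ρ′ (free≤ wfCρ)
      (Sum.map₂ (λ (i , i∈free , i∈J) → i , i∈free , fixed i∈J (proj₂ (∈-free⁻ {C = C} i∈free)))
                (settled⇒free-in-vars (⊑-∧ᶜˡ ρ (⋀ P)) (consistent maximal) wfCρ settled))
      where
      wfCρ : WellFormed (C ∧ᶜ ρ)
      wfCρ = WellFormed-antitone (∧ᶜ-mono ⊑-refl ρ⊑ρ′) wf′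

  bounded-by-width : ∀ k ρ → degree ρ +ℕ m * k ≤ D → Width k ρ → BoundedAt ρ
  bounded-by-consistent-width : ∀ k ρ → WellFormed ρ → degree ρ +ℕ m * k ≤ D → Width k ρ → BoundedAt ρ

  bounded-by-width k ρ deg width with WellFormed? ρ
  ... | yes wf  = bounded-by-consistent-width k ρ wf deg width
  ... | no  ill = bounded-inconsistent ill

  bounded-by-consistent-width zero ρ wf deg width =
    bounded-leaf wf (≤-trans (m≤m+n (degree ρ) (m * 0)) deg)
      (All.map (λ free≤0 wf′ → no-free⇒⊑ wf′ (∣p∣≤0⇒Empty (free≤0 wf′))) width)
  bounded-by-consistent-width (suc k) ρ wf deg width with greedy F ρ wf
  ... | P , P⊆F , maximal = decision-tree (elements (vars (⋀ P))) ρ λ ρ′ ρ⊑ρ′ fixed deg′ →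
    bounded-by-width k ρ′
      (degree-after-round deg′ (≤-trans (≤-reflexive (length-elements (vars (⋀ P))))
                                        (chosen-vars-bound ρ P P⊆F (consistent maximal))) deg)
      (width-decreases ρ P maximal ρ⊑ρ′ (λ i∈⋀P → All.lookup fixed (∈-elements i∈⋀P)) width)

  Ẽfam-bound : (t ∸ 1) * (d * d) ≤ D → Ẽfam E F ≤ℚ K
  Ẽfam-bound deg = begin
    Ẽfam E F                     ≡⟨ ∑-cong (λ C → cong (Ẽᶜ E) (∧ᶜ-identityʳ C)) F ⟨
    ∑ (λ C → Ẽᶜ E (C ∧ᶜ ⊤ᶜ)) F  ≤⟨ bounded-by-width d ⊤ᶜ deg₀ width₀ ⟩
    K · Ẽᶜ E ⊤ᶜ                  ≡⟨ cong (K ·_) (Ẽᶜ-⊤ᶜ E) ⟩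
    K · 1ℚ                       ≡⟨ ℚ.*-identityʳ K ⟩
    K                            ∎
    where
    open ℚ.≤-Reasoning
    deg₀ : degree (⊤ᶜ {n}) +ℕ m * d ≤ D
    deg₀ = ≤-trans (≤-reflexive (trans (cong (_+ℕ m * d) (degree-⊤ᶜ {n})) (*-assoc (t ∸ 1) d d))) deg
    width₀ : Width d ⊤ᶜ
    width₀ = All.map (λ {C} C≤d _ → ≤-trans (p⊆q⇒∣p∣≤∣q∣ (p∩q⊆p (vars C) _)) (≤-trans (∣vars∣≤degree C) C≤d))
                     degree≤d

mainTheorem15 : (n t d D : ℕ) → (t ∸ 1) * (d * d) ≤ n →
    (F : List (Conj n)) → Unique F → All WellFormed F → All (λ C → degree C ≤ d) F →
    (∀ (𝒮 : List (Conj n)) → 𝒮 ⊆ F → length 𝒮 ≡ t → IsZero (prodP (map conjP 𝒮))) →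
    (E : PseudoExpectation n D) → (t ∸ 1) * (d * d) ≤ D →
    Ẽfam E F Data.Rational.≤ ((+ (t ∸ 1)) / 1)
mainTheorem15 n t d D _ F _ _ degree≤d t-wise-inconsistent E deg =
  Ẽfam-bound F degree≤d t-wise-inconsistent E deg
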